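{- For every instance of $P_m(O_k)\,||\,C_{\max}$, the minimum makespan $C^{*}_{\max}$ satisfies $$\max\left\{\frac{P}{mk},\ \max_{1\le i\le n} P_i\right\}\ \le\ C^{*}_{\max}\ \le\ \frac{P}{m}+\max_{1\le i\le n}P_i .$$
   Context: The problem $P_m(O_k)\,||\,C_{\max}$: there are $m$ identical $k$-stage open shops $S_1,\dots,S_m$, where $S_\ell$ consists of machines $M_{\ell,1},\dots,M_{\ell,k}$, and $n$ jobs $J_1,\dots,J_n$. Job $J_i$ consists of $k$ operations $O_{i,1},\dots,O_{i,k}$ with nonnegative processing times $p_{i,1},\dots,p_{i,k}$. Each job is assigned to exactly one open shop $S_\ell$, and then operation $O_{i,j}$ is processed non-preemptively on machine $M_{\ell,j}$ for $p_{i,j}$ time units, in any order of the operations. Each machine processes at most one operation at a time and no two operations of the same job overlap in time. The makespan is the completion time of the last operation. $P_i=\sum_{j=1}^k p_{i,j}$ and $P=\sum_{i=1}^n P_i$.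
   Formalization: The processing times $p_{i,j}$ are rational, and the start times of schedules are taken in the rationals as well. -}

module Defs where

open import Data.Nat as ℕ using (ℕ; zero; suc)
open import Data.Fin using (Fin; zero; suc)
open import Data.Integer using (+_)
open import Data.Rational using (ℚ; 0ℚ; _+_; _*_; _≤_; _<_; _⊔_; _/_)
open import Data.Product using (_×_)
open import Relation.Nullary using (¬_)
open import Relation.Binary.PropositionalEquality using (_≡_; _≢_)

ℕ→ℚ : ℕ → ℚ
ℕ→ℚ n = + n / 1

Σ[<_]_ : (n : ℕ) → (Fin n → ℚ) → ℚ
Σ[< zero ] f = 0ℚ
Σ[< suc n ] f = f zero + Σ[< n ] (λ i → f (suc i))

-- finite maximum over Fin n (of nonnegative quantities; empty max = 0)
Max[<_]_ : (n : ℕ) → (Fin n → ℚ) → ℚ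
Max[< zero ] f = 0ℚ
Max[< suc n ] f = f zero ⊔ Max[< n ] (λ i → f (suc i))

record Instance (k n : ℕ) : Set where
  field
    p      : Fin n → Fin k → ℚ
    p-nonneg : ∀ i j → 0ℚ ≤ p i j

module _ {k n : ℕ} (I : Instance k n) where
  open Instance I

  Pjob : Fin n → ℚ
  Pjob i = Σ[< k ] (λ j → p i j)

  Ptot : ℚ
  Ptot = Σ[< n ] Pjob

  Pmax : ℚ
  Pmax = Max[< n ] Pjob

Overlap : ℚ → ℚ → ℚ → ℚ → Set
Overlap s d s' d' = (s < s' + d') × (s' < s + d)

-- A schedule on m identical k-stage open shops: job i goes to shop (shop i),
-- operation O_{i,j} runs non-preemptively on machine M_{shop i, j}
-- during [start i j , start i j + p i j).
record Schedule (m k n : ℕ) : Set where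
  field
    shop  : Fin n → Fin m
    start : Fin n → Fin k → ℚ

module _ {m k n : ℕ} (I : Instance k n) (σ : Schedule m k n) where
  open Instance I
  open Schedule σ

  record Feasible : Set where
    field
      start-nonneg : ∀ i j → 0ℚ ≤ start i j
      machine-ok : ∀ i i' j → i ≢ i' → shop i ≡ shop i' →
                   ¬ Overlap (start i j) (p i j) (start i' j) (p i' j)
      job-ok : ∀ i j j' → j ≢ j' →
               ¬ Overlap (start i j) (p i j) (start i j') (p i j')

  makespan : ℚ
  makespan = Max[< n ] (λ i → Max[< k ] (λ j → start i j + p i j))

{-# OPTIONS --safe #-}
-- Lower bounds: the operations of one job, and those on one machine, are pairwise disjoint
-- intervals inside [0, C], so each has total length at most C; hence P_i ≤ C, and summing
-- over the m k machines, P ≤ m k C.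
-- Upper bound: greedy list scheduling. Jobs are assigned one by one to a currently least
-- loaded shop and their operations run back to back from that shop's load onwards. The least
-- load is at most P/m, so every job completes by P/m + P_i.
module Submission where

open import Defs
open import Data.Nat using (ℕ; _≥_)
open import Data.Rational using (_≤_; _+_; _*_)
open import Data.Product using (_×_; Σ)

open import Algebra.Bundles using (CommutativeMonoid)
open import Data.Bool using (if_then_else_)
open import Data.Fin using (Fin; zero; suc; punchIn)
open import Data.Fin.Properties using (_≟_; punchIn-injective; punchInᵢ≢i)
import Data.Integer as ℤ
import Data.Integer.Properties as ℤ
open import Data.List using (allFin)
open import Data.List.Membership.Propositional.Properties using (∈-allFin)
open import Data.List.Relation.Unary.All as All using ()
open import Data.Nat using (zero; suc)
open import Data.Nat.Coprimality using (1-coprimeTo) renaming (sym to coprime-sym)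
open import Data.Product using (_,_; ∃-syntax; swap)
open import Data.Rational using (ℚ; 0ℚ; 1ℚ; _<_; _/_; _<?_; mkℚ; nonNegative)
open import Data.Rational.Properties hiding (_≟_)
open import Function using (_∘_; Injective)
open import Relation.Binary.Bundles using (DecTotalOrder)
open import Relation.Nullary using (¬_; Dec; yes; no; does; contradiction)
open import Relation.Binary.PropositionalEquality

open import Algebra.Properties.CommutativeSemigroup
  (CommutativeMonoid.commutativeSemigroup +-0-commutativeMonoid) using (interchange; x∙yz≈y∙xz)
open import Data.List.Extrema (DecTotalOrder.totalOrder ≤-decTotalOrder)
  using (argmin; argmax; f[argmin]≤f[xs]; f[xs]≤f[argmax])

ℕ→ℚ≡mkℚ : ∀ n → ℕ→ℚ n ≡ mkℚ (ℤ.+ n) 0 (coprime-sym (1-coprimeTo n))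
ℕ→ℚ≡mkℚ n = normalize-coprime (coprime-sym (1-coprimeTo n))

ℕ→ℚ-suc : ∀ n → ℕ→ℚ (suc n) ≡ 1ℚ + ℕ→ℚ n
ℕ→ℚ-suc n rewrite ℕ→ℚ≡mkℚ n = cong (λ x → (ℤ.+ 1 ℤ.+ x) / 1) (sym (ℤ.*-identityʳ (ℤ.+ n)))

ℕ→ℚ-nonneg : ∀ n → 0ℚ ≤ ℕ→ℚ n
ℕ→ℚ-nonneg n = subst (0ℚ ≤_) (sym (ℕ→ℚ≡mkℚ n)) (nonNegative⁻¹ _)

p≤p+q : ∀ {p q} → 0ℚ ≤ q → p ≤ p + q
p≤p+q {p} 0≤q = subst (_≤ p + _) (+-identityʳ p) (+-monoʳ-≤ p 0≤q)

p≤q+p : ∀ {p q} → 0ℚ ≤ q → p ≤ q + p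
p≤q+p {p} {q} 0≤q = subst (p ≤_) (+-comm p q) (p≤p+q 0≤q)

+-nonneg : ∀ {p q} → 0ℚ ≤ p → 0ℚ ≤ q → 0ℚ ≤ p + q
+-nonneg 0≤p 0≤q = ≤-trans 0≤p (p≤p+q 0≤q)

*-monoʳ-≤-of-nonneg : ∀ {r p q} → 0ℚ ≤ r → p ≤ q → r * p ≤ r * q
*-monoʳ-≤-of-nonneg {r} 0≤r = *-monoˡ-≤-nonNeg r {{nonNegative 0≤r}}

*-nonneg : ∀ {p q} → 0ℚ ≤ p → 0ℚ ≤ q → 0ℚ ≤ p * q
*-nonneg {p} {q} 0≤p 0≤q = subst (_≤ p * q) (*-zeroʳ p) (*-monoʳ-≤-of-nonneg 0≤p 0≤q)

<⇒≱ : ∀ {p q} → p < q → ¬ (q ≤ p)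
<⇒≱ p<q q≤p = <-irrefl refl (<-≤-trans p<q q≤p)

infix 8 _when_
_when_ : ∀ {P : Set} → ℚ → Dec P → ℚ
x when P? = if does P? then x else 0ℚ

when-nonneg : ∀ {P : Set} (P? : Dec P) {x} → 0ℚ ≤ x → 0ℚ ≤ x when P?
when-nonneg (yes _) 0≤x = 0≤x
when-nonneg (no  _) _   = ≤-refl

when-yes : ∀ {P : Set} (P? : Dec P) {x} → P → x when P? ≡ x
when-yes (yes _)  _ = refl
when-yes (no ¬p) p = contradiction p ¬p

when-+-≤ : ∀ {P : Set} (P? : Dec P) {x y c} → 0ℚ ≤ c → (P → x + y ≤ c) → x when P? + y when P? ≤ c
when-+-≤ (yes p) _ x+y≤c = x+y≤c p
when-+-≤ (no  _) {c = c} 0≤c _ = subst (_≤ c) (sym (+-identityʳ 0ℚ)) 0≤c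

Σ-cong : ∀ N {f g : Fin N → ℚ} → (∀ i → f i ≡ g i) → Σ[< N ] f ≡ Σ[< N ] g
Σ-cong zero    f≗g = refl
Σ-cong (suc N) f≗g = cong₂ _+_ (f≗g zero) (Σ-cong N (f≗g ∘ suc))

Σ-mono : ∀ N {f g : Fin N → ℚ} → (∀ i → f i ≤ g i) → Σ[< N ] f ≤ Σ[< N ] g
Σ-mono zero    f≤g = ≤-refl
Σ-mono (suc N) f≤g = +-mono-≤ (f≤g zero) (Σ-mono N (f≤g ∘ suc))

Σ-const : ∀ N c → Σ[< N ] (λ _ → c) ≡ ℕ→ℚ N * c
Σ-const zero    c = sym (*-zeroˡ c)
Σ-const (suc N) c = begin
  c + Σ[< N ] (λ _ → c)  ≡⟨ cong₂ _+_ (sym (*-identityˡ c)) (Σ-const N c) ⟩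
  1ℚ * c + ℕ→ℚ N * c     ≡⟨ sym (*-distribʳ-+ c 1ℚ (ℕ→ℚ N)) ⟩
  (1ℚ + ℕ→ℚ N) * c       ≡⟨ cong (_* c) (sym (ℕ→ℚ-suc N)) ⟩
  ℕ→ℚ (suc N) * c        ∎
  where open ≡-Reasoning

Σ-zero : ∀ N → Σ[< N ] (λ _ → 0ℚ) ≡ 0ℚ
Σ-zero N = trans (Σ-const N 0ℚ) (*-zeroʳ (ℕ→ℚ N))

Σ-nonneg : ∀ N {f : Fin N → ℚ} → (∀ i → 0ℚ ≤ f i) → 0ℚ ≤ Σ[< N ] f
Σ-nonneg N {f} 0≤f = subst (_≤ Σ[< N ] f) (Σ-zero N) (Σ-mono N 0≤f)

Σ-+ : ∀ N (f g : Fin N → ℚ) → Σ[< N ] (λ i → f i + g i) ≡ Σ[< N ] f + Σ[< N ] g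
Σ-+ zero    f g = sym (+-identityʳ 0ℚ)
Σ-+ (suc N) f g = trans (cong (f zero + g zero +_) (Σ-+ N (f ∘ suc) (g ∘ suc)))
                        (interchange (f zero) (g zero) _ _)

Σ-swap : ∀ A B (f : Fin A → Fin B → ℚ) →
         Σ[< A ] (λ i → Σ[< B ] (f i)) ≡ Σ[< B ] (λ j → Σ[< A ] (λ i → f i j))
Σ-swap zero    B f = sym (Σ-zero B)
Σ-swap (suc A) B f = trans (cong (Σ[< B ] (f zero) +_) (Σ-swap A B (f ∘ suc)))
                           (sym (Σ-+ B (f zero) _))

Σ-punchIn : ∀ {N} i (f : Fin (suc N) → ℚ) → Σ[< suc N ] f ≡ f i + Σ[< N ] (f ∘ punchIn i)
Σ-punchIn             zero    f = refl
Σ-punchIn {N = suc N} (suc i) f = begin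
  f zero + Σ[< suc N ] (f ∘ suc)                             ≡⟨ cong (f zero +_) (Σ-punchIn i (f ∘ suc)) ⟩
  f zero + (f (suc i) + Σ[< N ] (f ∘ suc ∘ punchIn i))       ≡⟨ x∙yz≈y∙xz (f zero) (f (suc i)) _ ⟩
  f (suc i) + (f zero + Σ[< N ] (f ∘ suc ∘ punchIn i))       ∎
  where open ≡-Reasoning

Σ-when-≟ : ∀ {N} (c : Fin N) x → Σ[< N ] (λ ℓ → x when (c ≟ ℓ)) ≡ x
Σ-when-≟ {suc N} zero    x = trans (cong (x +_) (Σ-zero N)) (+-identityʳ x)
Σ-when-≟ {suc N} (suc c) x = trans (+-identityˡ _) (Σ-when-≟ c x)

Max-nonneg : ∀ N (f : Fin N → ℚ) → 0ℚ ≤ Max[< N ] f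
Max-nonneg zero    f = ≤-refl
Max-nonneg (suc N) f = ≤-trans (Max-nonneg N (f ∘ suc)) (p≤q⊔p (f zero) _)

≤-Max : ∀ N (f : Fin N → ℚ) i → f i ≤ Max[< N ] f
≤-Max (suc N) f zero    = p≤p⊔q _ _
≤-Max (suc N) f (suc i) = ≤-trans (≤-Max N (f ∘ suc) i) (p≤q⊔p (f zero) _)

*-Max-lub : ∀ N {f : Fin N → ℚ} {r c} → 0ℚ ≤ r → 0ℚ ≤ c → (∀ i → r * f i ≤ c) → r * Max[< N ] f ≤ c
*-Max-lub zero    {r = r} _   0≤c _    = subst (_≤ _) (sym (*-zeroʳ r)) 0≤c
*-Max-lub (suc N) {f} {r} 0≤r 0≤c rf≤c =
  subst (_≤ _) (sym (*-distribˡ-⊔-nonNeg r {{nonNegative 0≤r}} (f zero) _))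
        (⊔-lub (rf≤c zero) (*-Max-lub N 0≤r 0≤c (rf≤c ∘ suc)))

Max-lub : ∀ N {f : Fin N → ℚ} {c} → 0ℚ ≤ c → (∀ i → f i ≤ c) → Max[< N ] f ≤ c
Max-lub zero    0≤c _   = 0≤c
Max-lub (suc N) 0≤c f≤c = ⊔-lub (f≤c zero) (Max-lub N 0≤c (f≤c ∘ suc))

maximiser : ∀ {N} (f : Fin (suc N) → ℚ) → ∃[ i ] (∀ j → f j ≤ f i)
maximiser f = argmax f zero (allFin _) , λ j → All.lookup (f[xs]≤f[argmax] {f = f} zero (allFin _)) (∈-allFin j)

minimiser : ∀ {N} (f : Fin (suc N) → ℚ) → ∃[ i ] (∀ j → f i ≤ f j)
minimiser f = argmin f zero (allFin _) , λ j → All.lookup (f[argmin]≤f[xs] {f = f} zero (allFin _)) (∈-allFin j)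

Disjoint : ∀ {N} → (Fin N → ℚ) → (Fin N → ℚ) → Set
Disjoint s d = ∀ i j → i ≢ j → ¬ Overlap (s i) (d i) (s j) (d j)

Disjoint-reindex : ∀ {M N} {s d : Fin N → ℚ} {f : Fin M → Fin N} →
                   Injective _≡_ _≡_ f → Disjoint s d → Disjoint (s ∘ f) (d ∘ f)
Disjoint-reindex f-inj disj i j i≢j = disj _ _ (i≢j ∘ f-inj)

ends-before⇒¬Overlap : ∀ {s d s′ d′} → s + d ≤ s′ → ¬ Overlap s d s′ d′
ends-before⇒¬Overlap s+d≤s′ (_ , s′<s+d) = <⇒≱ s′<s+d s+d≤s′

¬Overlap-point : ∀ {s d} → 0ℚ ≤ s → ¬ Overlap s d 0ℚ 0ℚ
¬Overlap-point {s} 0≤s (s<0+0 , _) = <⇒≱ (subst (s <_) (+-identityʳ 0ℚ) s<0+0) 0≤s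

¬Overlap⇒ends-before : ∀ {s d s′ d′} → s′ ≤ s → 0ℚ < d → ¬ Overlap s d s′ d′ → s′ + d′ ≤ s
¬Overlap⇒ends-before {s} s′≤s 0<d ¬overlap =
  ≮⇒≥ λ s<s′+d′ → ¬overlap (s<s′+d′ , ≤-<-trans s′≤s (subst (_< s + _) (+-identityʳ s) (+-monoʳ-< s 0<d)))

-- Masked-out intervals become empty intervals at time 0, which still overlap an interval
-- [s, s + d) with s < 0; hence the hypothesis on the starts.
Disjoint-when : ∀ {N} {P : Fin N → Set} (P? : ∀ i → Dec (P i)) {s d : Fin N → ℚ} →
                (∀ i → 0ℚ ≤ s i) → (∀ i j → i ≢ j → P i → P j → ¬ Overlap (s i) (d i) (s j) (d j)) →
                Disjoint (λ i → s i when P? i) (λ i → d i when P? i)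
Disjoint-when P? 0≤s disj i j i≢j with P? i | P? j
... | yes Pᵢ | yes Pⱼ = disj i j i≢j Pᵢ Pⱼ
... | yes _  | no  _  = ¬Overlap-point (0≤s i)
... | no  _  | yes _  = ¬Overlap-point (0≤s j) ∘ swap
... | no  _  | no  _  = ¬Overlap-point {0ℚ} {0ℚ} ≤-refl

-- Remove the interval that starts last: if it is nonempty, every other one ends before it starts.
disjoint⇒Σ≤ : ∀ N {s d : Fin N → ℚ} {b} → 0ℚ ≤ b → (∀ i → 0ℚ ≤ s i) → (∀ i → s i + d i ≤ b) →
              Disjoint s d → Σ[< N ] d ≤ b
disjoint⇒Σ≤ zero    0≤b _ _ _ = 0≤b
disjoint⇒Σ≤ (suc N) {s} {d} {b} 0≤b 0≤s end≤b disj = split-at-latest (maximiser s)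
  where
  split-at-latest : ∃[ i ] (∀ j → s j ≤ s i) → Σ[< suc N ] d ≤ b
  split-at-latest (i , s≤sᵢ) = begin
    Σ[< suc N ] d                  ≡⟨ Σ-punchIn i d ⟩
    d i + Σ[< N ] (d ∘ punchIn i)  ≤⟨ split (0ℚ <? d i) ⟩
    b                              ∎
    where
    open ≤-Reasoning
    rest≤ : ∀ {c} → 0ℚ ≤ c → (∀ j → s (punchIn i j) + d (punchIn i j) ≤ c) → Σ[< N ] (d ∘ punchIn i) ≤ c
    rest≤ 0≤c end≤c =
      disjoint⇒Σ≤ N 0≤c (0≤s ∘ punchIn i) end≤c (Disjoint-reindex (punchIn-injective i _ _) disj)
    split : Dec (0ℚ < d i) → d i + Σ[< N ] (d ∘ punchIn i) ≤ b
    split (no dᵢ≯0) =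
      subst (_ ≤_) (+-identityˡ b) (+-mono-≤ (≮⇒≥ dᵢ≯0) (rest≤ 0≤b (end≤b ∘ punchIn i)))
    split (yes 0<dᵢ) = begin
      d i + Σ[< N ] (d ∘ punchIn i)  ≤⟨ +-monoʳ-≤ (d i) (rest≤ (0≤s i) ends-before-i) ⟩
      d i + s i                      ≡⟨ +-comm (d i) (s i) ⟩
      s i + d i                      ≤⟨ end≤b i ⟩
      b                              ∎
      where
      ends-before-i : ∀ j → s (punchIn i j) + d (punchIn i j) ≤ s i
      ends-before-i j = ¬Overlap⇒ends-before (s≤sᵢ _) 0<dᵢ (disj i (punchIn i j) (punchInᵢ≢i i j ∘ sym))

-- Lower bounds

module _ {m k n} (I : Instance k n) (σ : Schedule m k n) (feasible : Feasible I σ) where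
  open Instance I
  open Schedule σ
  open Feasible feasible

  makespan-nonneg : 0ℚ ≤ makespan I σ
  makespan-nonneg = Max-nonneg n _

  end≤makespan : ∀ i j → start i j + p i j ≤ makespan I σ
  end≤makespan i j = ≤-trans (≤-Max k (λ j → start i j + p i j) j) (≤-Max n _ i)

  Pjob≤makespan : ∀ i → Pjob I i ≤ makespan I σ
  Pjob≤makespan i = disjoint⇒Σ≤ k makespan-nonneg (start-nonneg i) (end≤makespan i) (job-ok i)

  Pmax≤makespan : Pmax I ≤ makespan I σ
  Pmax≤makespan = Max-lub n makespan-nonneg Pjob≤makespan

  machineLoad≤makespan : ∀ ℓ j → Σ[< n ] (λ i → p i j when (shop i ≟ ℓ)) ≤ makespan I σ
  machineLoad≤makespan ℓ j =
    disjoint⇒Σ≤ n makespan-nonneg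
      (λ i → when-nonneg (shop i ≟ ℓ) (start-nonneg i j))
      (λ i → when-+-≤ (shop i ≟ ℓ) makespan-nonneg (λ _ → end≤makespan i j))
      (Disjoint-when (λ i → shop i ≟ ℓ) (λ i → start-nonneg i j)
        (λ i i′ i≢i′ i∈ℓ i′∈ℓ → machine-ok i i′ j i≢i′ (trans i∈ℓ (sym i′∈ℓ))))

  stageLoad≤m*makespan : ∀ j → Σ[< n ] (λ i → p i j) ≤ ℕ→ℚ m * makespan I σ
  stageLoad≤m*makespan j = begin
    Σ[< n ] (λ i → p i j)                                     ≡⟨ Σ-cong n (λ i → sym (Σ-when-≟ (shop i) (p i j))) ⟩
    Σ[< n ] (λ i → Σ[< m ] (λ ℓ → p i j when (shop i ≟ ℓ)))  ≡⟨ Σ-swap n m _ ⟩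
    Σ[< m ] (λ ℓ → Σ[< n ] (λ i → p i j when (shop i ≟ ℓ)))  ≤⟨ Σ-mono m (λ ℓ → machineLoad≤makespan ℓ j) ⟩
    Σ[< m ] (λ _ → makespan I σ)                              ≡⟨ Σ-const m _ ⟩
    ℕ→ℚ m * makespan I σ                                      ∎
    where open ≤-Reasoning

  Ptot≤mk*makespan : Ptot I ≤ ℕ→ℚ m * ℕ→ℚ k * makespan I σ
  Ptot≤mk*makespan = begin
    Σ[< n ] (λ i → Σ[< k ] (p i))           ≡⟨ Σ-swap n k p ⟩
    Σ[< k ] (λ j → Σ[< n ] (λ i → p i j))  ≤⟨ Σ-mono k stageLoad≤m*makespan ⟩
    Σ[< k ] (λ _ → ℕ→ℚ m * C)              ≡⟨ Σ-const k _ ⟩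
    ℕ→ℚ k * (ℕ→ℚ m * C)                    ≡⟨ sym (*-assoc (ℕ→ℚ k) (ℕ→ℚ m) C) ⟩
    ℕ→ℚ k * ℕ→ℚ m * C                      ≡⟨ cong (_* C) (*-comm (ℕ→ℚ k) (ℕ→ℚ m)) ⟩
    ℕ→ℚ m * ℕ→ℚ k * C                      ∎
    where
    open ≤-Reasoning
    C : ℚ
    C = makespan I σ

-- Greedy list scheduling

backToBack : ∀ {k} → ℚ → (Fin k → ℚ) → Fin k → ℚ
backToBack b f zero    = b
backToBack b f (suc j) = backToBack (b + f zero) (f ∘ suc) j

backToBack-≥ : ∀ {k} b {f : Fin k → ℚ} → (∀ j → 0ℚ ≤ f j) → ∀ j → b ≤ backToBack b f j
backToBack-≥ b 0≤f zero    = ≤-refl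
backToBack-≥ b 0≤f (suc j) = ≤-trans (p≤p+q (0≤f zero)) (backToBack-≥ _ (0≤f ∘ suc) j)

backToBack-end≤ : ∀ {k} b {f : Fin k → ℚ} → (∀ j → 0ℚ ≤ f j) → ∀ j → backToBack b f j + f j ≤ b + Σ[< k ] f
backToBack-end≤ {suc k} b {f} 0≤f zero    =
  subst (b + f zero ≤_) (+-assoc b (f zero) _) (p≤p+q (Σ-nonneg k (0≤f ∘ suc)))
backToBack-end≤ {suc k} b {f} 0≤f (suc j) =
  subst (backToBack (b + f zero) (f ∘ suc) j + f (suc j) ≤_) (+-assoc b (f zero) _)
        (backToBack-end≤ (b + f zero) (0≤f ∘ suc) j)

backToBack-disjoint : ∀ {k} b {f : Fin k → ℚ} → (∀ j → 0ℚ ≤ f j) → Disjoint (backToBack b f) f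
backToBack-disjoint b 0≤f zero    zero     0≢0 = contradiction refl 0≢0
backToBack-disjoint b 0≤f zero    (suc j′) _   = ends-before⇒¬Overlap (backToBack-≥ _ (0≤f ∘ suc) j′)
backToBack-disjoint b 0≤f (suc j) zero     _   = ends-before⇒¬Overlap (backToBack-≥ _ (0≤f ∘ suc) j) ∘ swap
backToBack-disjoint b 0≤f (suc j) (suc j′) j≢j′ =
  backToBack-disjoint _ (0≤f ∘ suc) j j′ (j≢j′ ∘ cong suc)

tailInstance : ∀ {k n} → Instance k (suc n) → Instance k n
tailInstance I = record { p = p ∘ suc ; p-nonneg = p-nonneg ∘ suc }
  where open Instance I

record LoadedSchedule (m k n : ℕ) (I : Instance k n) : Set where
  open Instance I
  field
    schedule : Schedule m k n
    feasible : Feasible I schedule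
    load     : Fin m → ℚ
  open Schedule schedule
  field
    load-nonneg : ∀ ℓ → 0ℚ ≤ load ℓ
    Σload≤Ptot  : Σ[< m ] load ≤ Ptot I
    end≤load    : ∀ i j → start i j + p i j ≤ load (shop i)
    m*end≤      : ∀ i j → ℕ→ℚ m * (start i j + p i j) ≤ Ptot I + ℕ→ℚ m * Pjob I i

emptySchedule : ∀ {m k} (I : Instance k zero) → LoadedSchedule m k zero I
emptySchedule {m} I = record
  { schedule    = record { shop = λ () ; start = λ () }
  ; feasible    = record { start-nonneg = λ () ; machine-ok = λ () ; job-ok = λ () }
  ; load        = λ _ → 0ℚ
  ; load-nonneg = λ _ → ≤-refl
  ; Σload≤Ptot  = ≤-reflexive (Σ-zero m)
  ; end≤load    = λ ()
  ; m*end≤      = λ ()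
  }

assignToLeastLoaded : ∀ {m k n} (I : Instance k (suc n)) →
                      LoadedSchedule (suc m) k n (tailInstance I) → LoadedSchedule (suc m) k (suc n) I
assignToLeastLoaded {m} {k} {n} I S = extend (minimiser load)
  where
  open Instance I
  open LoadedSchedule S
  open Schedule schedule
  open Feasible feasible

  M : ℚ
  M = ℕ→ℚ (suc m)

  P₀ : ℚ
  P₀ = Pjob I zero

  0≤P₀ : 0ℚ ≤ P₀
  0≤P₀ = Σ-nonneg k (p-nonneg zero)

  extend : ∃[ ℓ* ] (∀ ℓ → load ℓ* ≤ load ℓ) → LoadedSchedule (suc m) k (suc n) I
  extend (ℓ* , least) = record
    { schedule    = σ′
    ; feasible    = feasible′
    ; load        = load′
    ; load-nonneg = λ ℓ → +-nonneg (load-nonneg ℓ) (when-nonneg (ℓ* ≟ ℓ) 0≤P₀)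
    ; Σload≤Ptot  = Σload′≤Ptot
    ; end≤load    = end≤load′
    ; m*end≤      = m*end≤′
    }
    where
    start₀ : Fin k → ℚ
    start₀ = backToBack (load ℓ*) (p zero)

    load≤start₀ : ∀ j → load ℓ* ≤ start₀ j
    load≤start₀ = backToBack-≥ (load ℓ*) (p-nonneg zero)

    σ′ : Schedule (suc m) k (suc n)
    σ′ = record { shop  = λ { zero → ℓ* ; (suc i) → shop i }
                ; start = λ { zero → start₀ ; (suc i) → start i } }

    load′ : Fin (suc m) → ℚ
    load′ ℓ = load ℓ + P₀ when (ℓ* ≟ ℓ)

    load≤load′ : ∀ ℓ → load ℓ ≤ load′ ℓ
    load≤load′ ℓ = p≤p+q (when-nonneg (ℓ* ≟ ℓ) 0≤P₀)

    load′ℓ* : load′ ℓ* ≡ load ℓ* + P₀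
    load′ℓ* = cong (load ℓ* +_) (when-yes (ℓ* ≟ ℓ*) refl)

    end₀≤ : ∀ j → start₀ j + p zero j ≤ load ℓ* + P₀
    end₀≤ = backToBack-end≤ (load ℓ*) (p-nonneg zero)

    end-before₀ : ∀ i j → shop i ≡ ℓ* → start i j + p (suc i) j ≤ start₀ j
    end-before₀ i j refl = ≤-trans (end≤load i j) (load≤start₀ j)

    machine-ok′ : ∀ i i′ j → i ≢ i′ → Schedule.shop σ′ i ≡ Schedule.shop σ′ i′ →
                  ¬ Overlap (Schedule.start σ′ i j) (p i j) (Schedule.start σ′ i′ j) (p i′ j)
    machine-ok′ zero    zero     j 0≢0 _  = contradiction refl 0≢0
    machine-ok′ zero    (suc i′) j _   eq = ends-before⇒¬Overlap (end-before₀ i′ j (sym eq)) ∘ swap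
    machine-ok′ (suc i) zero     j _   eq = ends-before⇒¬Overlap (end-before₀ i j eq)
    machine-ok′ (suc i) (suc i′) j i≢i′ eq = machine-ok i i′ j (i≢i′ ∘ cong suc) eq

    feasible′ : Feasible I σ′
    feasible′ = record
      { start-nonneg = λ { zero j → ≤-trans (load-nonneg ℓ*) (load≤start₀ j) ; (suc i) → start-nonneg i }
      ; machine-ok   = machine-ok′
      ; job-ok       = λ { zero → backToBack-disjoint (load ℓ*) (p-nonneg zero) ; (suc i) → job-ok i }
      }

    Σload′≤Ptot : Σ[< suc m ] load′ ≤ Ptot I
    Σload′≤Ptot = begin
      Σ[< suc m ] load′                                        ≡⟨ Σ-+ (suc m) load (λ ℓ → P₀ when (ℓ* ≟ ℓ)) ⟩
      Σ[< suc m ] load + Σ[< suc m ] (λ ℓ → P₀ when (ℓ* ≟ ℓ))  ≡⟨ cong (Σ[< suc m ] load +_) (Σ-when-≟ ℓ* P₀) ⟩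
      Σ[< suc m ] load + P₀                                    ≤⟨ +-monoˡ-≤ P₀ Σload≤Ptot ⟩
      Ptot (tailInstance I) + P₀                               ≡⟨ +-comm _ P₀ ⟩
      Ptot I                                                   ∎
      where open ≤-Reasoning

    end≤load′ : ∀ i j → Schedule.start σ′ i j + p i j ≤ load′ (Schedule.shop σ′ i)
    end≤load′ zero    j = ≤-trans (end₀≤ j) (≤-reflexive (sym load′ℓ*))
    end≤load′ (suc i) j = ≤-trans (end≤load i j) (load≤load′ (shop i))

    m*end≤′ : ∀ i j → M * (Schedule.start σ′ i j + p i j) ≤ Ptot I + M * Pjob I i
    m*end≤′ zero    j = begin
      M * (start₀ j + p zero j)    ≤⟨ *-monoʳ-≤-of-nonneg 0≤M (end₀≤ j) ⟩
      M * (load ℓ* + P₀)           ≡⟨ *-distribˡ-+ M (load ℓ*) P₀ ⟩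
      M * load ℓ* + M * P₀         ≤⟨ +-monoˡ-≤ (M * P₀) M*least≤Ptot ⟩
      Ptot I + M * P₀              ∎
      where
      open ≤-Reasoning
      0≤M : 0ℚ ≤ M
      0≤M = ℕ→ℚ-nonneg (suc m)
      M*least≤Ptot : M * load ℓ* ≤ Ptot I
      M*least≤Ptot = begin
        M * load ℓ*                     ≡⟨ sym (Σ-const (suc m) (load ℓ*)) ⟩
        Σ[< suc m ] (λ _ → load ℓ*)     ≤⟨ Σ-mono (suc m) least ⟩
        Σ[< suc m ] load                ≤⟨ Σload≤Ptot ⟩
        Ptot (tailInstance I)           ≤⟨ p≤q+p 0≤P₀ ⟩
        Ptot I                          ∎
    m*end≤′ (suc i) j = ≤-trans (m*end≤ i j) (+-monoˡ-≤ _ (p≤q+p 0≤P₀))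

greedySchedule : ∀ m {k} n (I : Instance k n) → LoadedSchedule (suc m) k n I
greedySchedule m zero    I = emptySchedule I
greedySchedule m (suc n) I = assignToLeastLoaded I (greedySchedule m n (tailInstance I))

m*makespan≤ : ∀ {m k n} {I : Instance k n} (S : LoadedSchedule m k n I) →
              ℕ→ℚ m * makespan I (LoadedSchedule.schedule S) ≤ Ptot I + ℕ→ℚ m * Pmax I
m*makespan≤ {m} {k} {n} {I} S =
  *-Max-lub n 0≤M 0≤bound λ i → *-Max-lub k 0≤M 0≤bound λ j →
    ≤-trans (m*end≤ i j) (+-monoʳ-≤ (Ptot I) (*-monoʳ-≤-of-nonneg 0≤M (≤-Max n (Pjob I) i)))
  where
  open Instance I
  open LoadedSchedule S
  0≤M : 0ℚ ≤ ℕ→ℚ m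
  0≤M = ℕ→ℚ-nonneg m
  0≤bound : 0ℚ ≤ Ptot I + ℕ→ℚ m * Pmax I
  0≤bound = +-nonneg (Σ-nonneg n (λ i → Σ-nonneg k (p-nonneg i))) (*-nonneg 0≤M (Max-nonneg n (Pjob I)))

lemma1 : (m k n : ℕ) → m ≥ 1 → k ≥ 1 → (I : Instance k n) →
         ((σ : Schedule m k n) → Feasible I σ →
            (Ptot I ≤ ℕ→ℚ m * ℕ→ℚ k * makespan I σ) × (Pmax I ≤ makespan I σ))
         × Σ (Schedule m k n) (λ σ → Feasible I σ ×
             (ℕ→ℚ m * makespan I σ ≤ Ptot I + ℕ→ℚ m * Pmax I))
lemma1 zero    k n () _ I
lemma1 (suc m) k n _  _ I =
  (λ σ feasible → Ptot≤mk*makespan I σ feasible , Pmax≤makespan I σ feasible) ,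
  (schedule , feasible , m*makespan≤ S)
  where
  S : LoadedSchedule (suc m) k n I
  S = greedySchedule m n I
  open LoadedSchedule S
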